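{- Let $N$ be a binary normal network on $X$ with no near reticulations, and let $\{a,b\}$ be a reticulated cherry of $N$ with reticulation leaf $b$. Let $N'$ be the phylogenetic network obtained from $N$ by deleting $b$ and its parent, and suppressing the two resulting vertices of in-degree one and out-degree one. Then $N'$ is a binary normal network on $X-\{b\}$ with no near reticulations.
   Context: A (rooted) binary phylogenetic network $N$ on a non-empty finite set $X$ is an acyclic directed graph with a unique vertex of in-degree $0$ (the root) of out-degree $2$; $|X|$ vertices of in-degree $1$ and out-degree $0$ (leaves) bijectively labelled by $X$; and every other vertex either of in-degree $1$ and out-degree $2$ (tree vertex) or of in-degree $2$ and out-degree $1$ (reticulation). $N$ is tree-child if every non-leaf vertex has a child that is a tree vertex or leaf; a reticulation arc $(u,v)$ is a shortcut if there is another directed path from $u$ to $v$; $N$ is normal if tree-child with no shortcuts. $\{a,b\}$ is a reticulated cherry with reticulation leaf $b$ if the parent $p_b$ of $b$ is a reticulation and the parent of $a$ is a parent of $p_b$. Reticulations $u,v$ are near-sibling reticulations if some tree vertex has as its two children $v$ and a tree vertex that is a parent of $u$; near-stack reticulations if the child of $u$ is a tree vertex that is a parent of $v$; $N$ has no near reticulations if it has neither. Suppressing a vertex of in-degree one and out-degree one means replacing it and its two incident arcs by a single arc. -}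

module Defs where

open import Data.Nat using (ℕ)
open import Data.Fin using (Fin)
open import Data.Product using (Σ; _×_; _,_; proj₁; proj₂)
open import Data.Sum using (_⊎_; inj₁; inj₂)
open import Data.Empty using (⊥; ⊥-elim)
open import Data.Irrelevant using (Irrelevant; [_])
open import Data.Refinement using (Refinement; _,_; value)
open import Function.Bundles using (_↔_)
open import Relation.Nullary using (¬_; Dec)
open import Relation.Binary.PropositionalEquality using (_≡_; _≢_; refl; sym; trans; cong)
open import Relation.Binary.Construct.Closure.Transitive using (TransClosure)

Finite : Set → Set
Finite A = Σ ℕ λ n → A ↔ Fin n

-- A (simple) directed graph with leaf labelling by X.
-- Vertices: an arbitrary type V (finiteness is imposed in IsBinaryNetwork);
-- arcs: a relation Arc u v ("there is an arc u → v").

record Graph (X : Set) : Set₁ where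
  field
    V    : Set
    Arc  : V → V → Set
    leaf : X → V

module _ {X : Set} (G : Graph X) where
  open Graph G

  InDeg0 : V → Set
  InDeg0 v = ∀ u → ¬ Arc u v

  InDeg1 : V → Set
  InDeg1 v = Σ V λ u → Arc u v × (∀ w → Arc w v → w ≡ u)

  InDeg2 : V → Set
  InDeg2 v = Σ V λ u → Σ V λ w → u ≢ w × Arc u v × Arc w v
             × (∀ x → Arc x v → x ≡ u ⊎ x ≡ w)

  OutDeg0 : V → Set
  OutDeg0 v = ∀ u → ¬ Arc v u

  OutDeg1 : V → Set
  OutDeg1 v = Σ V λ u → Arc v u × (∀ w → Arc v w → w ≡ u)

  OutDeg2 : V → Set
  OutDeg2 v = Σ V λ u → Σ V λ w → u ≢ w × Arc v u × Arc v w
              × (∀ x → Arc v x → x ≡ u ⊎ x ≡ w)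

  Path⁺ : V → V → Set
  Path⁺ = TransClosure Arc

  Acyclic : Set
  Acyclic = ∀ v → ¬ Path⁺ v v

  IsTreeVertex : V → Set
  IsTreeVertex v = InDeg1 v × OutDeg2 v

  IsReticulation : V → Set
  IsReticulation v = InDeg2 v × OutDeg1 v

  IsLeaf : V → Set
  IsLeaf v = Σ X λ x → leaf x ≡ v

  record IsBinaryNetwork : Set where
    field
      finiteV   : Finite V
      finiteX   : Finite X
      nonemptyX : X
      arc?      : ∀ u v → Dec (Arc u v)
      acyclic   : Acyclic
      root      : V
      rootDeg   : InDeg0 root × OutDeg2 root
      leafDeg   : ∀ x → InDeg1 (leaf x) × OutDeg0 (leaf x)
      leafInj   : ∀ x y → leaf x ≡ leaf y → x ≡ y
      classify  : ∀ v → v ≡ root ⊎ IsLeaf v ⊎ IsTreeVertex v ⊎ IsReticulation v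

  TreeChild : Set
  TreeChild = ∀ v → ¬ IsLeaf v →
              Σ V λ c → Arc v c × (IsTreeVertex c ⊎ IsLeaf c)

  Shortcut : V → V → Set
  Shortcut u v = Arc u v × IsReticulation v × (Σ V λ w → Arc u w × Path⁺ w v)

  Normal : Set
  Normal = TreeChild × (∀ u v → ¬ Shortcut u v)

  NearSibling : V → V → Set
  NearSibling u v = IsReticulation u × IsReticulation v ×
    (Σ V λ t → Σ V λ w → IsTreeVertex t × Arc t v × Arc t w × IsTreeVertex w × Arc w u)

  NearStack : V → V → Set
  NearStack u v = IsReticulation u × IsReticulation v ×
    (Σ V λ c → Arc u c × IsTreeVertex c × Arc c v)

  NoNearReticulations : Set
  NoNearReticulations = ∀ u v → ¬ NearSibling u v × ¬ NearStack u v

  ReticulatedCherry : X → X → Set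
  ReticulatedCherry a b = a ≢ b × (Σ V λ pb → Σ V λ pa →
    Arc pb (leaf b) × IsReticulation pb × Arc pa (leaf a) × Arc pa pb)

  cherryRet : ∀ {a b} → ReticulatedCherry a b → V
  cherryRet c = proj₁ (proj₂ c)

  -- vertices removed: b, its parent p_b, and the parents of p_b
  -- (the two vertices that become in-degree 1 / out-degree 1 and get suppressed)
  Removed : X → V → V → Set
  Removed b pb v = v ≡ leaf b ⊎ v ≡ pb ⊎ Arc v pb

  keepLeaf : IsBinaryNetwork → ∀ {a b} (c : ReticulatedCherry a b) →
             ∀ x → x ≢ b → ¬ Removed b (cherryRet c) (leaf x)
  keepLeaf hN c x x≢b (inj₁ eq) = x≢b (IsBinaryNetwork.leafInj hN x _ eq)
  keepLeaf hN (_ , pb , pa , _ , ((u , w , u≢w , au , aw , _) , _) , _) x x≢b (inj₂ (inj₁ eq))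
    with IsBinaryNetwork.leafDeg hN x
  ... | (p , _ , uniq) , _ =
    u≢w (trans (uniq u (subst' au)) (sym (uniq w (subst' aw))))
    where
      subst' : ∀ {z} → Arc z pb → Arc z (leaf x)
      subst' a rewrite eq = a
  keepLeaf hN c x x≢b (inj₂ (inj₂ arc)) = proj₂ (IsBinaryNetwork.leafDeg hN x) _ arc

reduce : {X : Set} (G : Graph X) → IsBinaryNetwork G →
         ∀ {a b} → ReticulatedCherry G a b →
         Graph (Refinement X (λ x → x ≢ b))
reduce {X} G hN {a} {b} c = record
  { V    = V'
  ; Arc  = Arc'
  ; leaf = λ { (x , [ x≢b ]) → leaf x , [ keepLeaf G hN c x x≢b ] }
  }
  where
    open Graph G
    pb = cherryRet G c
    V' : Set
    V' = Refinement V (λ v → ¬ Removed G b pb v)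
    Arc' : V' → V' → Set
    Arc' x y = Arc (value x) (value y)
             ⊎ (Σ V λ p → Arc p pb × Arc (value x) p × Arc p (value y))

-- The vertices of N′ are those of N other than b, p_b and the two parents of p_b, and each keeps
-- its neighbours, except that a parent p of p_b is replaced by the parent of p among in-neighbours
-- and by the sibling of p_b among out-neighbours. Normality makes both parents of p_b tree vertices
-- whose other child is a tree vertex or a leaf, so these replacements are bijections of
-- neighbourhoods and every vertex keeps its type. An arc of N′ through a suppressed vertex never
-- ends in a reticulation, so a shortcut of N′ lifts to one of N, and a near pair of N′ is either
-- one of N or becomes one of N involving p_b.

module Submission where

open import Level using (0ℓ)
open import Data.Nat using (ℕ; zero; suc; _<_; _≤_; s≤s)
open import Data.Nat.Properties using (m≤n⇒m<n∨m≡n; ≤-pred; <⇒≤; n<1+n)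
open import Data.Fin using (Fin; zero; suc; toℕ)
open import Data.Fin.Properties using (pigeonhole; toℕ<n; inj⇒≟)
open import Data.Product using (Σ; _×_; _,_; proj₁; proj₂)
open import Data.Sum using (_⊎_; inj₁; inj₂)
import Data.Sum as Sum
open import Data.Empty using (⊥-elim; ⊥-elim-irr)
open import Data.Irrelevant using ([_])
open import Data.Refinement using (Refinement; _,_; value; value-injective)
open import Function.Base using (_∘_)
open import Function.Bundles using (_↔_; Inverse; Injection; mk↔ₛ′)
open import Function.Properties.Inverse using (↔-trans; ↔⇒↣)
open import Relation.Nullary using (¬_; Dec; yes; no)
open import Relation.Nullary.Decidable using (_×-dec_; _⊎-dec_; ¬?; map′)
open import Relation.Unary using (Pred; Empty; Decidable)
open import Relation.Binary.Definitions using (DecidableEquality)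
open import Relation.Binary.PropositionalEquality using (_≡_; _≢_; refl; sym; trans; cong; subst)
open import Relation.Binary.Construct.Closure.Transitive using ([_]; _∷_; _∷ʳ_; _++_)
open import Defs

finite-≟ : {A : Set} → Finite A → DecidableEquality A
finite-≟ (_ , e) = inj⇒≟ (↔⇒↣ e)

refinement-cong : {A B : Set} {P : Pred A 0ℓ} (e : A ↔ B) →
                  Refinement A P ↔ Refinement B (P ∘ Inverse.from e)
refinement-cong {P = P} e = mk↔ₛ′ to′ from′
  (λ (y , _) → value-injective (strictlyInverseˡ y))
  (λ (x , _) → value-injective (strictlyInverseʳ x))
  where
  open Inverse e
  to′ : Refinement _ P → Refinement _ (P ∘ from)
  to′ (x , [ p ]) = to x , [ subst P (sym (strictlyInverseʳ x)) p ]
  from′ : Refinement _ (P ∘ from) → Refinement _ P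
  from′ (y , [ p ]) = from y , [ p ]

Fin-refinement-finite : ∀ {n} {Q : Pred (Fin n) 0ℓ} → Decidable Q → Finite (Refinement (Fin n) Q)
Fin-refinement-finite {zero} Q? = 0 , mk↔ₛ′ (λ { (() , _) }) (λ ()) (λ ()) (λ { (() , _) })
Fin-refinement-finite {suc n} {Q} Q? with Fin-refinement-finite (Q? ∘ suc) | Q? zero
... | m , e | yes q₀ = suc m , mk↔ₛ′ to′ from′ inverseˡ′ inverseʳ′
  where
  open Inverse e
  to′ : Refinement (Fin (suc n)) Q → Fin (suc m)
  to′ (zero  , _)     = zero
  to′ (suc i , [ q ]) = suc (to (i , [ q ]))
  from′ : Fin (suc m) → Refinement (Fin (suc n)) Q
  from′ zero    = zero , [ q₀ ]
  from′ (suc k) = suc (value (from k)) , Refinement.proof (from k)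
  inverseˡ′ : ∀ k → to′ (from′ k) ≡ k
  inverseˡ′ zero    = refl
  inverseˡ′ (suc k) = cong suc (strictlyInverseˡ k)
  inverseʳ′ : ∀ r → from′ (to′ r) ≡ r
  inverseʳ′ (zero  , _) = refl
  inverseʳ′ (suc i , [ q ]) = value-injective (cong (suc ∘ value) (strictlyInverseʳ (i , [ q ])))
... | m , e | no ¬q₀ = m , mk↔ₛ′ to′ from′ strictlyInverseˡ inverseʳ′
  where
  open Inverse e
  to′ : Refinement (Fin (suc n)) Q → Fin m
  to′ (zero  , [ q ]) = ⊥-elim-irr (¬q₀ q)
  to′ (suc i , [ q ]) = to (i , [ q ])
  from′ : Fin m → Refinement (Fin (suc n)) Q
  from′ k = suc (value (from k)) , Refinement.proof (from k)
  inverseʳ′ : ∀ r → from′ (to′ r) ≡ r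
  inverseʳ′ (zero  , [ q ]) = ⊥-elim-irr (¬q₀ q)
  inverseʳ′ (suc i , [ q ]) = value-injective (cong (suc ∘ value) (strictlyInverseʳ (i , [ q ])))

refinement-finite : {A : Set} {P : Pred A 0ℓ} → Finite A → Decidable P → Finite (Refinement A P)
refinement-finite (n , e) P? with Fin-refinement-finite (P? ∘ Inverse.from e)
... | m , e′ = m , ↔-trans (refinement-cong e) e′

module _ {A : Set} where

  ExactlyOne : Pred A 0ℓ → Set
  ExactlyOne P = Σ A λ u → P u × (∀ w → P w → w ≡ u)

  ExactlyTwo : Pred A 0ℓ → Set
  ExactlyTwo P = Σ A λ u → Σ A λ w → u ≢ w × P u × P w × (∀ x → P x → x ≡ u ⊎ x ≡ w)

  exactlyOne-unique : ∀ {P u w} → ExactlyOne P → P u → P w → u ≡ w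
  exactlyOne-unique (_ , _ , unique) pu pw = trans (unique _ pu) (sym (unique _ pw))

  exactlyOne⇒¬exactlyTwo : ∀ {P} → ExactlyOne P → ¬ ExactlyTwo P
  exactlyOne⇒¬exactlyTwo one (_ , _ , u≢w , pu , pw , _) = u≢w (exactlyOne-unique one pu pw)

  exactlyTwo-other-unique : ∀ {P s v w} → ExactlyTwo P → P s → P v → P w →
                            v ≢ s → w ≢ s → v ≡ w
  exactlyTwo-other-unique (_ , _ , _ , _ , _ , only) ps pv pw v≢s w≢s
    with only _ ps | only _ pv | only _ pw
  ... | _         | inj₁ refl | inj₁ refl = refl
  ... | _         | inj₂ refl | inj₂ refl = refl
  ... | inj₁ refl | inj₁ refl | inj₂ _    = ⊥-elim (v≢s refl)
  ... | inj₂ refl | inj₁ _    | inj₂ refl = ⊥-elim (w≢s refl)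
  ... | inj₁ refl | inj₂ _    | inj₁ refl = ⊥-elim (w≢s refl)
  ... | inj₂ refl | inj₂ refl | inj₁ _    = ⊥-elim (v≢s refl)

record Correspondence {A B : Set} (P : Pred A 0ℓ) (Q : Pred B 0ℓ) : Set₁ where
  field
    _∼_        : A → B → Set
    forth      : ∀ {a} → P a → Σ B λ b → Q b × a ∼ b
    back       : ∀ {b} → Q b → Σ A λ a → P a × a ∼ b
    functional : ∀ {a b b′} → P a → Q b → Q b′ → a ∼ b → a ∼ b′ → b ≡ b′
    injective  : ∀ {a a′ b} → P a → P a′ → Q b → a ∼ b → a′ ∼ b → a ≡ a′

module _ {A B : Set} {P : Pred A 0ℓ} {Q : Pred B 0ℓ} (C : Correspondence P Q) where
  open Correspondence C

  correspondence-sym : Correspondence Q P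
  correspondence-sym = record
    { _∼_        = λ b a → a ∼ b
    ; forth      = back
    ; back       = forth
    ; functional = λ qb pa pa′ → injective pa pa′ qb
    ; injective  = λ qb qb′ pa → functional pa qb qb′
    }

  correspondence-empty : Empty P → Empty Q
  correspondence-empty none b qb = none _ (proj₁ (proj₂ (back qb)))

  correspondence-exactlyOne : ExactlyOne P → ExactlyOne Q
  correspondence-exactlyOne (a , pa , unique) with forth pa
  ... | b , qb , a∼b = b , qb , only
    where
    only : ∀ b′ → Q b′ → b′ ≡ b
    only b′ qb′ with back qb′
    ... | a′ , pa′ , a′∼b′ with unique a′ pa′
    ... | refl = functional pa qb′ qb a′∼b′ a∼b

  correspondence-exactlyTwo : ExactlyTwo P → ExactlyTwo Q
  correspondence-exactlyTwo (a₁ , a₂ , a₁≢a₂ , pa₁ , pa₂ , only-a) with forth pa₁ | forth pa₂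
  ... | b₁ , qb₁ , a₁∼b₁ | b₂ , qb₂ , a₂∼b₂ = b₁ , b₂ , b₁≢b₂ , qb₁ , qb₂ , only
    where
    b₁≢b₂ : b₁ ≢ b₂
    b₁≢b₂ refl = a₁≢a₂ (injective pa₁ pa₂ qb₁ a₁∼b₁ a₂∼b₂)
    only : ∀ b → Q b → b ≡ b₁ ⊎ b ≡ b₂
    only b qb with back qb
    ... | a , pa , a∼b with only-a a pa
    ... | inj₁ refl = inj₁ (functional pa qb qb₁ a∼b a₁∼b₁)
    ... | inj₂ refl = inj₂ (functional pa qb qb₂ a∼b a₂∼b₂)

module Network {X : Set} (N : Graph X) (hN : IsBinaryNetwork N) where
  open Graph N
  open IsBinaryNetwork hN

  TreeOrLeaf : V → Set
  TreeOrLeaf v = IsTreeVertex N v ⊎ IsLeaf N v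

  treeOrLeaf⇒inDeg1 : ∀ {v} → TreeOrLeaf v → InDeg1 N v
  treeOrLeaf⇒inDeg1 (inj₁ (in1 , _))  = in1
  treeOrLeaf⇒inDeg1 (inj₂ (x , refl)) = proj₁ (leafDeg x)

  reticulation⇒¬treeOrLeaf : ∀ {v} → IsReticulation N v → ¬ TreeOrLeaf v
  reticulation⇒¬treeOrLeaf (in2 , _) tl = exactlyOne⇒¬exactlyTwo (treeOrLeaf⇒inDeg1 tl) in2

  arc⇒¬leaf : ∀ {v y} → Arc v y → ¬ IsLeaf N v
  arc⇒¬leaf v→y (x , refl) = proj₂ (leafDeg x) _ v→y

  arc⇒≢root : ∀ {u v} → Arc u v → v ≢ root
  arc⇒≢root u→v refl = proj₁ rootDeg _ u→v

  has-parent : ∀ v → v ≢ root → Σ V λ u → Arc u v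
  has-parent v v≢root with classify v
  ... | inj₁ v≡root                                   = ⊥-elim (v≢root v≡root)
  ... | inj₂ (inj₁ (x , refl))                        = let (u , u→v , _) = proj₁ (leafDeg x) in u , u→v
  ... | inj₂ (inj₂ (inj₁ ((u , u→v , _) , _)))         = u , u→v
  ... | inj₂ (inj₂ (inj₂ ((u , _ , _ , u→v , _) , _))) = u , u→v

  Reachable : V → Set
  Reachable v = v ≡ root ⊎ Path⁺ N root v

  BackWalk : ℕ → V → Set
  BackWalk k v = Σ (ℕ → V) λ w → w 0 ≡ v × (∀ {m} → m < k → Arc (w (suc m)) (w m))

  reachable-or-backWalk : ∀ k v → Reachable v ⊎ BackWalk k v
  reachable-or-backWalk zero v = inj₂ ((λ _ → v) , refl , λ ())
  reachable-or-backWalk (suc k) v with finite-≟ finiteV v root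
  ... | yes v≡root = inj₁ (inj₁ v≡root)
  ... | no v≢root with has-parent v v≢root
  ... | u , u→v with reachable-or-backWalk k u
  ... | inj₁ (inj₁ refl)       = inj₁ (inj₂ [ u→v ])
  ... | inj₁ (inj₂ root⇝u)    = inj₁ (inj₂ (root⇝u ∷ʳ u→v))
  ... | inj₂ (w , refl , arcs) = inj₂ (w′ , refl , arcs′)
    where
    w′ : ℕ → V
    w′ zero    = v
    w′ (suc m) = w m
    arcs′ : ∀ {m} → m < suc k → Arc (w′ (suc m)) (w′ m)
    arcs′ {zero}  _         = u→v
    arcs′ {suc m} (s≤s m<k) = arcs m<k

  backWalk-path : ∀ {k} (w : ℕ → V) → (∀ {m} → m < k → Arc (w (suc m)) (w m)) →
                  ∀ {i j} → i < j → j ≤ k → Path⁺ N (w j) (w i)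
  backWalk-path w arcs {i} {suc j} (s≤s i≤j) j<k with m≤n⇒m<n∨m≡n i≤j
  ... | inj₂ refl = [ arcs j<k ]
  ... | inj₁ i<j  = arcs j<k ∷ backWalk-path w arcs i<j (<⇒≤ j<k)

  -- A back-walk longer than the number of vertices repeats a vertex, which acyclicity forbids.
  reachable : ∀ v → Reachable v
  reachable v with reachable-or-backWalk (proj₁ finiteV) v
  ... | inj₁ r = r
  ... | inj₂ (w , _ , arcs)
    with i , j , i<j , same ← pigeonhole (n<1+n _) (Inverse.to (proj₂ finiteV) ∘ w ∘ toℕ)
    = ⊥-elim (acyclic _ (subst (Path⁺ N (w (toℕ j))) wi≡wj
                          (backWalk-path w arcs i<j (≤-pred (toℕ<n j)))))
    where
    wi≡wj : w (toℕ i) ≡ w (toℕ j)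
    wi≡wj = Injection.injective (↔⇒↣ (proj₂ finiteV)) same

module Reduction {X : Set} (N : Graph X) (hN : IsBinaryNetwork N) (normal : Normal N)
                 {a b : X} (cherry : ReticulatedCherry N a b) where
  open Graph N
  open IsBinaryNetwork hN
  open Network N hN

  private
    treeChild : TreeChild N
    treeChild = proj₁ normal

    noShortcut : ∀ u v → ¬ Shortcut N u v
    noShortcut = proj₂ normal

  pb : V
  pb = cherryRet N cherry

  pb→b : Arc pb (leaf b)
  pb→b = let (_ , _ , _ , pb→b , _) = cherry in pb→b

  pb-reticulation : IsReticulation N pb
  pb-reticulation = let (_ , _ , _ , _ , ret , _) = cherry in ret

  pb-has-parent : Σ V λ pa → Arc pa pb
  pb-has-parent = let (_ , _ , pa , _ , _ , _ , pa→pb) = cherry in pa , pa→pb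

  pb-child : ∀ {y} → Arc pb y → y ≡ leaf b
  pb-child pb→y = exactlyOne-unique (proj₂ pb-reticulation) pb→y pb→b

  b-parent : ∀ {u} → Arc u (leaf b) → u ≡ pb
  b-parent u→b = exactlyOne-unique (proj₁ (leafDeg b)) u→b pb→b

  pb-other-parent : ∀ {p} → Arc p pb → Σ V λ p′ → p′ ≢ p × Arc p′ pb
  pb-other-parent {p} p→pb with proj₁ pb-reticulation
  ... | u , w , u≢w , u→pb , w→pb , only with only p p→pb
  ... | inj₁ refl = w , (λ w≡u → u≢w (sym w≡u)) , w→pb
  ... | inj₂ refl = u , u≢w , u→pb

  path⇒pb-shortcut : ∀ {p p′} → Arc p pb → Path⁺ N p p′ → Arc p′ pb → Shortcut N p pb
  path⇒pb-shortcut p→pb [ p→p′ ]        p′→pb = p→pb , pb-reticulation , _ , p→p′ , [ p′→pb ]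
  path⇒pb-shortcut p→pb (p→q ∷ q⇝p′) p′→pb = p→pb , pb-reticulation , _ , p→q , q⇝p′ ∷ʳ p′→pb

  -- The root is excluded because the other parent of p_b is reachable from it.
  pb-parent-tree : ∀ {p} → Arc p pb → IsTreeVertex N p
  pb-parent-tree {p} p→pb with classify p
  ... | inj₂ (inj₂ (inj₁ tree)) = tree
  ... | inj₂ (inj₁ leaf-p)      = ⊥-elim (arc⇒¬leaf p→pb leaf-p)
  ... | inj₂ (inj₂ (inj₂ (_ , one-child))) with treeChild p (arc⇒¬leaf p→pb)
  ...   | c , p→c , tl = ⊥-elim (reticulation⇒¬treeOrLeaf pb-reticulation
                           (subst TreeOrLeaf (exactlyOne-unique one-child p→c p→pb) tl))
  pb-parent-tree {p} p→pb | inj₁ refl with pb-other-parent p→pb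
  ... | p′ , p′≢root , p′→pb with reachable p′
  ...   | inj₁ p′≡root  = ⊥-elim (p′≢root p′≡root)
  ...   | inj₂ root⇝p′ = ⊥-elim (noShortcut _ _ (path⇒pb-shortcut p→pb root⇝p′ p′→pb))

  pb-sibling-unique : ∀ {p v w} → Arc p pb → Arc p v → Arc p w → v ≢ pb → w ≢ pb → v ≡ w
  pb-sibling-unique p→pb = exactlyTwo-other-unique (proj₂ (pb-parent-tree p→pb)) p→pb

  pb-sibling : ∀ {p} → Arc p pb → Σ V λ s → Arc p s × TreeOrLeaf s × s ≢ pb
  pb-sibling {p} p→pb with treeChild p (arc⇒¬leaf p→pb)
  ... | s , p→s , tl = s , p→s , tl , λ { refl → reticulation⇒¬treeOrLeaf pb-reticulation tl }

  pb-sibling-treeOrLeaf : ∀ {p v} → Arc p pb → Arc p v → v ≢ pb → TreeOrLeaf v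
  pb-sibling-treeOrLeaf p→pb p→v v≢pb with pb-sibling p→pb
  ... | s , p→s , tl , s≢pb = subst TreeOrLeaf (pb-sibling-unique p→pb p→s p→v s≢pb v≢pb) tl

  Removed′ : V → Set
  Removed′ = Removed N b pb

  removed? : Decidable Removed′
  removed? v = finite-≟ finiteV v (leaf b) ⊎-dec finite-≟ finiteV v pb ⊎-dec arc? v pb

  removed-parent⇒pb-parent : ∀ {u v} → Removed′ u → Arc u v → ¬ Removed′ v → Arc u pb
  removed-parent⇒pb-parent (inj₁ refl)          b→v  _  = ⊥-elim (arc⇒¬leaf b→v (b , refl))
  removed-parent⇒pb-parent (inj₂ (inj₁ refl))   pb→v ¬r = ⊥-elim (¬r (inj₁ (pb-child pb→v)))
  removed-parent⇒pb-parent (inj₂ (inj₂ u→pb)) _    _  = u→pb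

  removed-child⇒pb-parent : ∀ {v y} → ¬ Removed′ v → Arc v y → Removed′ y → Arc y pb
  removed-child⇒pb-parent ¬r v→b  (inj₁ refl)          = ⊥-elim (¬r (inj₂ (inj₁ (b-parent v→b))))
  removed-child⇒pb-parent ¬r v→pb (inj₂ (inj₁ refl))   = ⊥-elim (¬r (inj₂ (inj₂ v→pb)))
  removed-child⇒pb-parent _  _    (inj₂ (inj₂ y→pb)) = y→pb

  pb-grandparent-kept : ∀ {p g} → Arc p pb → Arc g p → ¬ Removed′ g
  pb-grandparent-kept p→pb b→p  (inj₁ refl)          = arc⇒¬leaf b→p (b , refl)
  pb-grandparent-kept p→pb pb→p (inj₂ (inj₁ refl)) with pb-child pb→p
  ... | refl = arc⇒¬leaf p→pb (b , refl)
  pb-grandparent-kept p→pb g→p  (inj₂ (inj₂ g→pb)) =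
    noShortcut _ _ (g→pb , pb-reticulation , _ , g→p , [ p→pb ])

  pb-sibling-kept : ∀ {p s} → Arc p pb → Arc p s → s ≢ pb → ¬ Removed′ s
  pb-sibling-kept p→pb p→b _ (inj₁ refl) with b-parent p→b
  ... | refl = acyclic pb [ p→pb ]
  pb-sibling-kept p→pb p→s s≢pb (inj₂ (inj₁ s≡pb)) = s≢pb s≡pb
  pb-sibling-kept p→pb p→s s≢pb (inj₂ (inj₂ s→pb)) =
    noShortcut _ _ (p→pb , pb-reticulation , _ , p→s , [ s→pb ])

  N′ : Graph (Refinement X (λ x → x ≢ b))
  N′ = reduce N hN cherry

  V′ : Set
  V′ = Graph.V N′

  Arc′ : V′ → V′ → Set
  Arc′ = Graph.Arc N′

  kept : (x : V′) → ¬ Removed′ (value x)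
  kept (_ , [ ¬r ]) r = ⊥-elim-irr (¬r r)

  kept-≢pb : (x : V′) → value x ≢ pb
  kept-≢pb x x≡pb = kept x (inj₂ (inj₁ x≡pb))

  kept-¬pb-parent : (x : V′) → ¬ Arc (value x) pb
  kept-¬pb-parent x x→pb = kept x (inj₂ (inj₂ x→pb))

  pb-sibling-inDeg1 : ∀ {p} (x : V′) → Arc p pb → Arc p (value x) → InDeg1 N (value x)
  pb-sibling-inDeg1 x p→pb p→x = treeOrLeaf⇒inDeg1 (pb-sibling-treeOrLeaf p→pb p→x (kept-≢pb x))

  arc′⇒path : ∀ {x y} → Arc′ x y → Path⁺ N (value x) (value y)
  arc′⇒path (inj₁ x→y)               = [ x→y ]
  arc′⇒path (inj₂ (_ , _ , x→p , p→y)) = x→p ∷ [ p→y ]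

  path′⇒path : ∀ {x y} → Path⁺ N′ x y → Path⁺ N (value x) (value y)
  path′⇒path {x} {y} [ x→y ]                = arc′⇒path {x} {y} x→y
  path′⇒path {x} (_∷_ {y = y} x→y y⇝z) = arc′⇒path {x} {y} x→y ++ path′⇒path y⇝z

  -- A parent u of v in N stands for itself in N′, or, if u is a parent of p_b, for the parent of u.
  ParentImage : V → V′ → Set
  ParentImage u x = value x ≡ u ⊎ (Arc u pb × Arc (value x) u)

  -- A child y of v in N stands for itself in N′, or, if y is a parent of p_b, for the sibling of p_b.
  ChildImage : V → V′ → Set
  ChildImage y x = value x ≡ y ⊎ (Arc y pb × Arc y (value x) × TreeOrLeaf (value x))

  in-correspondence : (v′ : V′) → Correspondence (λ u → Arc u (value v′)) (λ x → Arc′ x v′)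
  in-correspondence v′ = record
    { _∼_        = ParentImage
    ; forth      = forth
    ; back       = λ {x} → back {x}
    ; functional = λ {y x x′} → functional {y} {x} {x′}
    ; injective  = λ {y y′ x} → injective {y} {y′} {x}
    }
    where
    v : V
    v = value v′

    forth : ∀ {u} → Arc u v → Σ V′ λ x → Arc′ x v′ × ParentImage u x
    forth {u} u→v with removed? u
    ... | no ¬r = (u , [ ¬r ]) , inj₁ u→v , inj₁ refl
    ... | yes r =
      let u→pb = removed-parent⇒pb-parent r u→v (kept v′)
          (g , g→u , _) = proj₁ (pb-parent-tree u→pb)
      in (g , [ pb-grandparent-kept u→pb g→u ]) , inj₂ (u , u→pb , g→u , u→v) , inj₂ (u→pb , g→u)

    back : ∀ {x} → Arc′ x v′ → Σ V λ u → Arc u v × ParentImage u x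
    back (inj₁ x→v)                    = _ , x→v , inj₁ refl
    back (inj₂ (p , p→pb , x→p , p→v)) = p , p→v , inj₂ (p→pb , x→p)

    functional : ∀ {u x x′} → Arc u v → Arc′ x v′ → Arc′ x′ v′ →
                 ParentImage u x → ParentImage u x′ → x ≡ x′
    functional _ _ _ (inj₁ refl) (inj₁ x′≡u) = value-injective (sym x′≡u)
    functional {x = x}  _ _ _ (inj₁ refl) (inj₂ (x→pb , _)) = ⊥-elim (kept-¬pb-parent x x→pb)
    functional {x′ = x′} _ _ _ (inj₂ (x′→pb , _)) (inj₁ refl) = ⊥-elim (kept-¬pb-parent x′ x′→pb)
    functional _ _ _ (inj₂ (u→pb , x→u)) (inj₂ (_ , x′→u)) =
      value-injective (exactlyOne-unique (proj₁ (pb-parent-tree u→pb)) x→u x′→u)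

    injective : ∀ {u u′ x} → Arc u v → Arc u′ v → Arc′ x v′ →
                ParentImage u x → ParentImage u′ x → u ≡ u′
    injective _ _ _ (inj₁ refl) (inj₁ refl) = refl
    injective u→v u′→v _ (inj₂ (u→pb , _)) _ =
      exactlyOne-unique (pb-sibling-inDeg1 v′ u→pb u→v) u→v u′→v
    injective u→v u′→v _ (inj₁ _) (inj₂ (u′→pb , _)) =
      exactlyOne-unique (pb-sibling-inDeg1 v′ u′→pb u′→v) u→v u′→v

  out-correspondence : (v′ : V′) → Correspondence (λ y → Arc (value v′) y) (λ x → Arc′ v′ x)
  out-correspondence v′ = record
    { _∼_        = ChildImage
    ; forth      = forth
    ; back       = λ {x} → back {x}
    ; functional = λ {y x x′} → functional {y} {x} {x′}
    ; injective  = λ {y y′ x} → injective {y} {y′} {x}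
    }
    where
    v : V
    v = value v′

    forth : ∀ {y} → Arc v y → Σ V′ λ x → Arc′ v′ x × ChildImage y x
    forth {y} v→y with removed? y
    ... | no ¬r = (y , [ ¬r ]) , inj₁ v→y , inj₁ refl
    ... | yes r =
      let y→pb = removed-child⇒pb-parent (kept v′) v→y r
          (s , y→s , tl , s≢pb) = pb-sibling y→pb
      in (s , [ pb-sibling-kept y→pb y→s s≢pb ]) , inj₂ (y , y→pb , v→y , y→s) , inj₂ (y→pb , y→s , tl)

    back : ∀ {x} → Arc′ v′ x → Σ V λ y → Arc v y × ChildImage y x
    back (inj₁ v→x) = _ , v→x , inj₁ refl
    back {x} (inj₂ (p , p→pb , v→p , p→x)) =
      p , v→p , inj₂ (p→pb , p→x , pb-sibling-treeOrLeaf p→pb p→x (kept-≢pb x))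

    functional : ∀ {y x x′} → Arc v y → Arc′ v′ x → Arc′ v′ x′ →
                 ChildImage y x → ChildImage y x′ → x ≡ x′
    functional _ _ _ (inj₁ refl) (inj₁ x′≡y) = value-injective (sym x′≡y)
    functional {x = x}  _ _ _ (inj₁ refl) (inj₂ (x→pb , _)) = ⊥-elim (kept-¬pb-parent x x→pb)
    functional {x′ = x′} _ _ _ (inj₂ (x′→pb , _)) (inj₁ refl) = ⊥-elim (kept-¬pb-parent x′ x′→pb)
    functional {x = x} {x′} _ _ _ (inj₂ (y→pb , y→x , _)) (inj₂ (_ , y→x′ , _)) =
      value-injective (pb-sibling-unique y→pb y→x y→x′ (kept-≢pb x) (kept-≢pb x′))

    -- If y is a parent of p_b, the image x has in-degree one, so y is its only parent.
    injective : ∀ {y y′ x} → Arc v y → Arc v y′ → Arc′ v′ x →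
                ChildImage y x → ChildImage y′ x → y ≡ y′
    injective _ _ _ (inj₁ refl) (inj₁ refl) = refl
    injective _ v→x _ (inj₂ (y→pb , y→x , tl)) (inj₁ refl)
      with refl ← exactlyOne-unique (treeOrLeaf⇒inDeg1 tl) y→x v→x = ⊥-elim (kept-¬pb-parent v′ y→pb)
    injective v→x _ _ (inj₁ refl) (inj₂ (y′→pb , y′→x , tl))
      with refl ← exactlyOne-unique (treeOrLeaf⇒inDeg1 tl) y′→x v→x = ⊥-elim (kept-¬pb-parent v′ y′→pb)
    injective _ _ _ (inj₂ (_ , y→x , tl)) (inj₂ (_ , y′→x , _)) =
      exactlyOne-unique (treeOrLeaf⇒inDeg1 tl) y→x y′→x

  tree-forth : ∀ v′ → IsTreeVertex N (value v′) → IsTreeVertex N′ v′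
  tree-forth v′ (in1 , out2) =
    correspondence-exactlyOne (in-correspondence v′) in1 ,
    correspondence-exactlyTwo (out-correspondence v′) out2

  tree-back : ∀ v′ → IsTreeVertex N′ v′ → IsTreeVertex N (value v′)
  tree-back v′ (in1 , out2) =
    correspondence-exactlyOne (correspondence-sym (in-correspondence v′)) in1 ,
    correspondence-exactlyTwo (correspondence-sym (out-correspondence v′)) out2

  reticulation-forth : ∀ v′ → IsReticulation N (value v′) → IsReticulation N′ v′
  reticulation-forth v′ (in2 , out1) =
    correspondence-exactlyTwo (in-correspondence v′) in2 ,
    correspondence-exactlyOne (out-correspondence v′) out1

  reticulation-back : ∀ v′ → IsReticulation N′ v′ → IsReticulation N (value v′)
  reticulation-back v′ (in2 , out1) =
    correspondence-exactlyTwo (correspondence-sym (in-correspondence v′)) in2 ,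
    correspondence-exactlyOne (correspondence-sym (out-correspondence v′)) out1

  leaf-forth : ∀ v′ → IsLeaf N (value v′) → IsLeaf N′ v′
  leaf-forth v′ (x , x≡v) = (x , [ x≢b ]) , value-injective x≡v
    where
    x≢b : x ≢ b
    x≢b refl = kept v′ (inj₁ (sym x≡v))

  treeOrLeaf-forth : ∀ v′ → TreeOrLeaf (value v′) → IsTreeVertex N′ v′ ⊎ IsLeaf N′ v′
  treeOrLeaf-forth v′ = Sum.map (tree-forth v′) (leaf-forth v′)

  pb-sibling-¬reticulation′ : ∀ {p} (x : V′) → Arc p pb → Arc p (value x) → ¬ IsReticulation N′ x
  pb-sibling-¬reticulation′ x p→pb p→x ret =
    reticulation⇒¬treeOrLeaf (reticulation-back x ret) (pb-sibling-treeOrLeaf p→pb p→x (kept-≢pb x))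

  root-kept : ¬ Removed′ root
  root-kept (inj₁ root≡b)          = arc⇒≢root pb→b (sym root≡b)
  root-kept (inj₂ (inj₁ root≡pb))  = arc⇒≢root (proj₂ pb-has-parent) (sym root≡pb)
  root-kept (inj₂ (inj₂ root→pb)) = let (u , u→root , _) = proj₁ (pb-parent-tree root→pb)
                                     in arc⇒≢root u→root refl

  root′ : V′
  root′ = root , [ root-kept ]

  -- Only the two parents of p_b can carry an arc of N′ through a suppressed vertex.
  arc′? : ∀ x y → Dec (Arc′ x y)
  arc′? x y with proj₁ pb-reticulation
  ... | u , w , _ , u→pb , w→pb , only =
    arc? (value x) (value y) ⊎-dec
    map′ through through⁻¹ ((arc? (value x) u ×-dec arc? u (value y)) ⊎-dec
                            (arc? (value x) w ×-dec arc? w (value y)))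
    where
    Through : V → Set
    Through p = Arc p pb × Arc (value x) p × Arc p (value y)
    through : (Arc (value x) u × Arc u (value y)) ⊎ (Arc (value x) w × Arc w (value y)) →
              Σ V Through
    through (inj₁ (x→u , u→y)) = u , u→pb , x→u , u→y
    through (inj₂ (x→w , w→y)) = w , w→pb , x→w , w→y
    through⁻¹ : Σ V Through →
                (Arc (value x) u × Arc u (value y)) ⊎ (Arc (value x) w × Arc w (value y))
    through⁻¹ (p , p→pb , x→p , p→y) with only p p→pb
    ... | inj₁ refl = inj₁ (x→p , p→y)
    ... | inj₂ refl = inj₂ (x→p , p→y)

  binaryNetwork′ : IsBinaryNetwork N′
  binaryNetwork′ = record
    { finiteV   = refinement-finite finiteV (¬? ∘ removed?)
    ; finiteX   = refinement-finite finiteX (λ x → ¬? (finite-≟ finiteX x b))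
    ; nonemptyX = a , [ proj₁ cherry ]
    ; arc?      = arc′?
    ; acyclic   = λ v cycle → acyclic (value v) (path′⇒path cycle)
    ; root      = root′
    ; rootDeg   = correspondence-empty (in-correspondence root′) (proj₁ rootDeg) ,
                  correspondence-exactlyTwo (out-correspondence root′) (proj₂ rootDeg)
    ; leafDeg   = λ x → correspondence-exactlyOne (in-correspondence (leaf′ x)) (proj₁ (leafDeg (value x))) ,
                        correspondence-empty (out-correspondence (leaf′ x)) (proj₂ (leafDeg (value x)))
    ; leafInj   = λ x y eq → value-injective (leafInj _ _ (cong value eq))
    ; classify  = classify′
    }
    where
    leaf′ : Refinement X (λ x → x ≢ b) → V′
    leaf′ = Graph.leaf N′
    classify′ : ∀ v → v ≡ root′ ⊎ IsLeaf N′ v ⊎ IsTreeVertex N′ v ⊎ IsReticulation N′ v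
    classify′ v with classify (value v)
    ... | inj₁ v≡root                 = inj₁ (value-injective v≡root)
    ... | inj₂ (inj₁ leaf-v)         = inj₂ (inj₁ (leaf-forth v leaf-v))
    ... | inj₂ (inj₂ (inj₁ tree))    = inj₂ (inj₂ (inj₁ (tree-forth v tree)))
    ... | inj₂ (inj₂ (inj₂ ret))     = inj₂ (inj₂ (inj₂ (reticulation-forth v ret)))

  -- A child c of v in N that gets removed is a parent of p_b; then the sibling of p_b takes its place.
  treeChild′ : TreeChild N′
  treeChild′ v ¬leaf with treeChild (value v) (¬leaf ∘ leaf-forth v)
  ... | c , v→c , tl with removed? c
  ... | no ¬r = (c , [ ¬r ]) , inj₁ v→c , treeOrLeaf-forth (c , [ ¬r ]) tl
  ... | yes r =
    let c→pb = removed-child⇒pb-parent (kept v) v→c r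
        (s , c→s , tl′ , s≢pb) = pb-sibling c→pb
        s′ = s , [ pb-sibling-kept c→pb c→s s≢pb ]
    in s′ , inj₂ (c , c→pb , v→c , c→s) , treeOrLeaf-forth s′ tl′

  noShortcut′ : ∀ u v → ¬ Shortcut N′ u v
  noShortcut′ u v (inj₂ (p , p→pb , _ , p→v) , ret , _) = pb-sibling-¬reticulation′ v p→pb p→v ret
  noShortcut′ u v (inj₁ u→v , ret , w , inj₁ u→w , w⇝v) =
    noShortcut _ _ (u→v , reticulation-back v ret , _ , u→w , path′⇒path w⇝v)
  noShortcut′ u v (inj₁ u→v , ret , w , inj₂ (p , _ , u→p , p→w) , w⇝v) =
    noShortcut _ _ (u→v , reticulation-back v ret , p , u→p , p→w ∷ path′⇒path w⇝v)

  -- A near pair of N′ using a suppressed arc t → p → w or u → p → c is one with p_b in N.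
  noNearReticulations′ : NoNearReticulations N → NoNearReticulations N′
  noNearReticulations′ noNear u v = noNearSibling , noNearStack
    where
    noNearSibling : ¬ NearSibling N′ u v
    noNearSibling (_ , rv , _ , _ , _ , inj₂ (p , p→pb , _ , p→v) , _) =
      pb-sibling-¬reticulation′ v p→pb p→v rv
    noNearSibling (ru , _ , _ , _ , _ , _ , _ , _ , inj₂ (p , p→pb , _ , p→u)) =
      pb-sibling-¬reticulation′ u p→pb p→u ru
    noNearSibling (ru , rv , t , w , tt , inj₁ t→v , inj₁ t→w , tw , inj₁ w→u) =
      proj₁ (noNear _ _) (reticulation-back u ru , reticulation-back v rv , _ , _ ,
                          tree-back t tt , t→v , t→w , tree-back w tw , w→u)
    noNearSibling (_ , rv , t , _ , tt , inj₁ t→v , inj₂ (p , p→pb , t→p , _) , _ , inj₁ _) =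
      proj₁ (noNear pb _) (pb-reticulation , reticulation-back v rv , _ , p ,
                           tree-back t tt , t→v , t→p , pb-parent-tree p→pb , p→pb)
    noNearStack : ¬ NearStack N′ u v
    noNearStack (_ , rv , _ , _ , _ , inj₂ (p , p→pb , _ , p→v)) =
      pb-sibling-¬reticulation′ v p→pb p→v rv
    noNearStack (ru , rv , c , inj₁ u→c , tc , inj₁ c→v) =
      proj₂ (noNear _ _) (reticulation-back u ru , reticulation-back v rv , _ , u→c , tree-back c tc , c→v)
    noNearStack (ru , _ , _ , inj₂ (p , p→pb , u→p , _) , _ , inj₁ _) =
      proj₂ (noNear _ pb) (reticulation-back u ru , pb-reticulation , p , u→p , pb-parent-tree p→pb , p→pb)

lemma5p1 : {X : Set} (N : Graph X) (hN : IsBinaryNetwork N) →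
    Normal N → NoNearReticulations N →
    (a b : X) (c : ReticulatedCherry N a b) →
    IsBinaryNetwork (reduce N hN c) × Normal (reduce N hN c)
      × NoNearReticulations (reduce N hN c)
lemma5p1 N hN normal noNear a b cherry =
  binaryNetwork′ , (treeChild′ , noShortcut′) , noNearReticulations′ noNear
  where open Reduction N hN normal cherry
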